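{- Let $G$ be a finite bipartite graph with color classes $A$ and $B$, and $b:V(G)\to\mathbb{Z}_{\ge0}$. Let $Z$ be a $b$-verifying set, and let $Z_1:=(Z\cap A)\cup(B\setminus Z)$ and $Z_2:=(A\setminus Z)\cup(Z\cap B)$. Then (i) $Z_1$ and $Z_2$ are separating; (ii) every inconsistent flexible component $C$ hooked up by $A$ satisfies $V(C)\subseteq Z_1$, and every inconsistent flexible component $C$ hooked up by $B$ satisfies $V(C)\subseteq Z_2$; (iii) no flexible component is inconsistent hooked up by both $A$ and $B$.
   Context: A $b$-matching is $M\subseteq E(G)$ with at most $b(v)$ edges of $M$ at each vertex $v$; maximum = largest cardinality; $v$ is $M$-loose if fewer than $b(v)$ edges of $M$ are incident with it. An edge is allowed if in some maximum $b$-matching, forbidden otherwise; an allowed edge is inevitable if in every maximum $b$-matching, flexible otherwise. Flexible components: induced subgraphs $G[V(K)]$, $K$ a connected component of $(V(G),\{\text{flexible edges}\})$. A set of vertices is separating if it is empty or a union of vertex sets of flexible components. $\mathcal{D}$: vertices $M$-loose for some maximum $b$-matching $M$. A flexible component $C$ is loose if $V(C)\cap\mathcal{D}\ne\emptyset$; $v$ is inactive if $b(v)=0$ (then $G[\{v\}]$ is an inactive flexible component). For $W\in\{A,B\}$, $C$ is inconsistent hooked up by $W$ if $C$ is loose with $V(C)\cap\mathcal{D}\cap W\ne\emptyset$, or $C$ is inactive and its vertex has a neighbor in $\mathcal{D}\cap W$. $E[X]$: edges with both ends in $X$; $b(X)=\sum_{v\in X}b(v)$. $Z$ is $b$-verifying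 if $b(V(G)\setminus Z)+|E[Z]|$ equals the size of a maximum $b$-matching. -}

module Defs where

open import Data.Nat using (ℕ; _≤_; _<_; _+_)
open import Data.Bool using (Bool; true; false; _∧_; _∨_; if_then_else_)
open import Data.Fin using (Fin; _≟_)
open import Data.Fin.Subset using (Subset; _∈_; _∉_; ∣_∣; _∩_; _∪_; ∁)
open import Data.Fin.Subset.Properties using (_∈?_)
open import Data.Vec using (Vec; tabulate; lookup)
open import Data.Vec using (sum) public
open import Data.Product using (Σ; ∃; _×_; _,_)
open import Data.Sum using (_⊎_)
open import Relation.Nullary using (¬_; ⌊_⌋)
open import Relation.Binary.PropositionalEquality using (_≡_)
open import Relation.Binary.Construct.Closure.ReflexiveTransitive using (Star)

record BipGraph : Set where
  field
    n     : ℕ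
    m     : ℕ
    A     : Subset n
    end₁  : Fin m → Fin n
    end₂  : Fin m → Fin n
    end₁∈A : ∀ e → end₁ e ∈ A
    end₂∉A : ∀ e → end₂ e ∉ A
    simple : ∀ e f → end₁ e ≡ end₁ f → end₂ e ≡ end₂ f → e ≡ f

  B : Subset n
  B = ∁ A

module _ (G : BipGraph) (b : Fin (BipGraph.n G) → ℕ) where
  open BipGraph G

  inc : Fin n → Subset m
  inc v = tabulate (λ e → ⌊ end₁ e ≟ v ⌋ ∨ ⌊ end₂ e ≟ v ⌋)

  deg : Subset m → Fin n → ℕ
  deg M v = ∣ M ∩ inc v ∣

  IsBMatching : Subset m → Set
  IsBMatching M = ∀ v → deg M v ≤ b v

  IsMaximum : Subset m → Set
  IsMaximum M = IsBMatching M × (∀ M' → IsBMatching M' → ∣ M' ∣ ≤ ∣ M ∣)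

  Loose : Subset m → Fin n → Set
  Loose M v = deg M v < b v

  Allowed : Fin m → Set
  Allowed e = ∃ λ M → IsMaximum M × e ∈ M

  Inevitable : Fin m → Set
  Inevitable e = Allowed e × (∀ M → IsMaximum M → e ∈ M)

  Flexible : Fin m → Set
  Flexible e = Allowed e × ¬ Inevitable e

  FlexAdj : Fin n → Fin n → Set
  FlexAdj u v = ∃ λ e → Flexible e ×
    ((end₁ e ≡ u × end₂ e ≡ v) ⊎ (end₁ e ≡ v × end₂ e ≡ u))

  FlexConn : Fin n → Fin n → Set
  FlexConn = Star FlexAdj

  -- A flexible component is given by any of its vertices r;
  -- its vertex set is { v | FlexConn r v }.
  InComp : Fin n → Fin n → Set
  InComp r v = FlexConn r v

  Adj : Fin n → Fin n → Set
  Adj u v = ∃ λ e → (end₁ e ≡ u × end₂ e ≡ v) ⊎ (end₁ e ≡ v × end₂ e ≡ u)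

  InD : Fin n → Set
  InD v = ∃ λ M → IsMaximum M × Loose M v

  LooseComp : Fin n → Set
  LooseComp r = ∃ λ v → InComp r v × InD v

  InactiveComp : Fin n → Fin n → Set
  InactiveComp r v = b v ≡ 0 × (∀ u → (InComp r u → u ≡ v) × (u ≡ v → InComp r u))

  InconsistentHooked : Subset n → Fin n → Set
  InconsistentHooked W r =
    (LooseComp r × (∃ λ v → InComp r v × InD v × v ∈ W))
    ⊎ (∃ λ v → InactiveComp r v × (∃ λ u → Adj v u × InD u × u ∈ W))

  -- separating: empty, or a union of vertex sets of flexible components
  Separating : Subset n → Set
  Separating X =
    (∀ v → v ∉ X)
    ⊎ (∃ λ (R : Subset n) → ∀ v → (v ∈ X → ∃ λ r → r ∈ R × InComp r v)
                                  × ((∃ λ r → r ∈ R × InComp r v) → v ∈ X))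

  bSum : Subset n → ℕ
  bSum X = sum (tabulate (λ v → if ⌊ v ∈? X ⌋ then b v else 0))

  EdgesIn : Subset n → Subset m
  EdgesIn Z = tabulate (λ e → ⌊ end₁ e ∈? Z ⌋ ∧ ⌊ end₂ e ∈? Z ⌋)

  BVerifying : Subset n → Set
  BVerifying Z = ∃ λ M → IsMaximum M × bSum (∁ Z) + ∣ EdgesIn Z ∣ ≡ ∣ M ∣

  Z₁ : Subset n → Subset n
  Z₁ Z = (Z ∩ A) ∪ (B ∩ ∁ Z)

  Z₂ : Subset n → Subset n
  Z₂ Z = (A ∩ ∁ Z) ∪ (Z ∩ B)

-- A maximum b-matching M meets the bound |M| ≤ b(V ∖ Z) + |E[Z]|, obtained by charging
-- each edge of M either to E[Z] or to an end outside Z, and then bounding the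
-- degrees outside Z by b.  When Z is b-verifying both steps are tight for every
-- maximum M: edges inside Z are inevitable, edges with no end in Z are forbidden,
-- and vertices outside Z are never loose.  Hence every flexible edge has exactly
-- one end in Z, so the parity "v ∈ Z xor v ∈ A" is constant on flexible
-- components; Z₂ is where it is true and Z₁ where it is false.  A component hooked
-- up by A (resp. B) has parity false (resp. true), because 𝒟 ⊆ Z and an inactive
-- vertex next to Z must lie outside Z.
module Submission where

open import Defs
open import Data.Bool using (Bool; true; false; not; _∧_; _∨_; _xor_; if_then_else_)
open import Data.Bool.Properties using (∨-zeroʳ; not-involutive)
open import Data.Empty using (⊥; ⊥-elim)
open import Data.Fin using (Fin; zero; suc; _≟_)
open import Data.Fin.Properties using (suc-injective)
open import Data.Fin.Subset using (Subset; inside; outside; _∈_; _∉_; ∣_∣; _∩_; ∁)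
open import Data.Fin.Subset.Properties using (_∈?_; x∈p∩q⁺; x∈∁p⇒x∉p; x∈p⇒∣p-x∣<∣p∣)
open import Data.Nat using (ℕ; zero; suc; _+_; _*_; _≤_; _<_; z≤n; s≤s)
open import Data.Nat.Properties
  using (+-*-semiring; ≤-refl; ≤-trans; ≤-<-trans; ≤-antisym; +-mono-≤; +-monoʳ-≤; +-cancelˡ-≤; +-cancelʳ-≤;
         +-comm; +-identityʳ; *-identityˡ; *-identityʳ; *-zeroʳ; *-monoˡ-≤; *-cancelʳ-≡; <⇒≢; module ≤-Reasoning)
open import Algebra.Properties.Semiring.Sum +-*-semiring
  using (sum-cong-≗; ∑-distrib-+; ∑-comm; *-distribʳ-sum; sum-replicate-zero)
  renaming (sum to ∑)
open import Data.Product using (_×_; _,_; proj₁; proj₂)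
open import Data.Sum using (inj₁; inj₂)
open import Data.Vec using ([]; _∷_; tabulate; lookup)
open import Data.Vec.Properties using (lookup-map; lookup-zipWith; lookup∘tabulate; []=⇒lookup; lookup⇒[]=)
open import Function using (_∘_)
open import Relation.Binary.Construct.Closure.ReflexiveTransitive using (ε; fold)
open import Relation.Binary.PropositionalEquality
open import Relation.Nullary using (¬_; yes; no; does; ⌊_⌋; contradiction)
open import Relation.Nullary.Decidable using (isYes≗does)

𝟙 : Bool → ℕ
𝟙 true = 1
𝟙 false = 0

if-then-0≡*𝟙 : ∀ c x → (if c then x else 0) ≡ x * 𝟙 c
if-then-0≡*𝟙 true x = sym (*-identityʳ x)
if-then-0≡*𝟙 false x = sym (*-zeroʳ x)

not-xor-not : ∀ x y → not x xor not y ≡ x xor y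
not-xor-not true y = refl
not-xor-not false y = not-involutive y

lookup≡false : ∀ {k} {x : Fin k} {p : Subset k} → x ∉ p → lookup p x ≡ false
lookup≡false {x = x} {p} x∉p with lookup p x in eq
... | true = contradiction (lookup⇒[]= x p eq) x∉p
... | false = refl

⌊x∈?p⌋≡lookup : ∀ {k} (x : Fin k) (p : Subset k) → ⌊ x ∈? p ⌋ ≡ lookup p x
⌊x∈?p⌋≡lookup x p = trans (isYes≗does (x ∈? p)) (does-∈? x p)
  where
  does-∈? : ∀ {k} (x : Fin k) (p : Subset k) → does (x ∈? p) ≡ lookup p x
  does-∈? zero (inside ∷ p) = refl
  does-∈? zero (outside ∷ p) = refl
  does-∈? (suc x) (_ ∷ p) = does-∈? x p

sum∘tabulate : ∀ {k} (f : Fin k → ℕ) → sum (tabulate f) ≡ ∑ f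
sum∘tabulate {zero} f = refl
sum∘tabulate {suc k} f = cong (f zero +_) (sum∘tabulate (f ∘ suc))

∣p∣≡∑𝟙 : ∀ {k} (p : Subset k) → ∣ p ∣ ≡ ∑ (𝟙 ∘ lookup p)
∣p∣≡∑𝟙 [] = refl
∣p∣≡∑𝟙 (inside ∷ p) = cong suc (∣p∣≡∑𝟙 p)
∣p∣≡∑𝟙 (outside ∷ p) = ∣p∣≡∑𝟙 p

∑-mono-≤ : ∀ {k} {f g : Fin k → ℕ} → (∀ i → f i ≤ g i) → ∑ f ≤ ∑ g
∑-mono-≤ {zero} f≤g = z≤n
∑-mono-≤ {suc k} f≤g = +-mono-≤ (f≤g zero) (∑-mono-≤ (f≤g ∘ suc))

∑-mono-≤-tight : ∀ {k} {f g : Fin k → ℕ} → (∀ i → f i ≤ g i) → ∑ g ≤ ∑ f → ∀ i → f i ≡ g i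
∑-mono-≤-tight {suc k} {f} {g} f≤g ∑g≤∑f zero = ≤-antisym (f≤g zero) g₀≤f₀
  where
  open ≤-Reasoning
  g₀≤f₀ : g zero ≤ f zero
  g₀≤f₀ = +-cancelʳ-≤ (∑ (g ∘ suc)) (g zero) (f zero) (begin
    ∑ g                      ≤⟨ ∑g≤∑f ⟩
    ∑ f                      ≤⟨ +-mono-≤ ≤-refl (∑-mono-≤ (f≤g ∘ suc)) ⟩
    f zero + ∑ (g ∘ suc)     ∎)
∑-mono-≤-tight {suc k} {f} {g} f≤g ∑g≤∑f (suc i) = ∑-mono-≤-tight (f≤g ∘ suc) ∑g′≤∑f′ i
  where
  open ≤-Reasoning
  ∑g′≤∑f′ : ∑ (g ∘ suc) ≤ ∑ (f ∘ suc)
  ∑g′≤∑f′ = +-cancelˡ-≤ (g zero) _ _ (begin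
    ∑ g                      ≤⟨ ∑g≤∑f ⟩
    ∑ f                      ≤⟨ +-mono-≤ (f≤g zero) ≤-refl ⟩
    g zero + ∑ (f ∘ suc)     ∎)

∑-single : ∀ {k} (g : Fin k → ℕ) (c : Fin k) → (∀ v → c ≢ v → g v ≡ 0) → ∑ g ≡ g c
∑-single {suc k} g zero g≡0 = begin
  g zero + ∑ (g ∘ suc)         ≡⟨ cong (g zero +_) (sum-cong-≗ (λ v → g≡0 (suc v) (λ ()))) ⟩
  g zero + ∑ {k} (λ _ → 0)     ≡⟨ cong (g zero +_) (sum-replicate-zero k) ⟩
  g zero + 0                   ≡⟨ +-identityʳ (g zero) ⟩
  g zero                       ∎
  where open ≡-Reasoning
∑-single {suc k} g (suc c) g≡0 rewrite g≡0 zero (λ ()) =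
  ∑-single (g ∘ suc) c (λ v c≢v → g≡0 (suc v) (c≢v ∘ suc-injective))

∑-δ : ∀ {k} (c : Fin k) (f : Fin k → ℕ) → ∑ (λ v → 𝟙 ⌊ c ≟ v ⌋ * f v) ≡ f c
∑-δ c f = trans (∑-single _ c off-c) at-c
  where
  off-c : ∀ v → c ≢ v → 𝟙 ⌊ c ≟ v ⌋ * f v ≡ 0
  off-c v c≢v with c ≟ v
  ... | yes c≡v = contradiction c≡v c≢v
  ... | no _ = refl
  at-c : 𝟙 ⌊ c ≟ c ⌋ * f c ≡ f c
  at-c with c ≟ c
  ... | yes _ = *-identityˡ (f c)
  ... | no c≢c = contradiction refl c≢c

-- The share of an edge in the bound b(V ∖ Z) + |E[Z]|: m says whether it lies in
-- the matching, x and y whether its ends lie in Z.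
charge : (m x y : Bool) → ℕ
charge m x y = 𝟙 (x ∧ y) + 𝟙 m * (𝟙 (not x) + 𝟙 (not y))

𝟙≤charge : ∀ m x y → 𝟙 m ≤ charge m x y
𝟙≤charge false x y = z≤n
𝟙≤charge true true true = s≤s z≤n
𝟙≤charge true true false = s≤s z≤n
𝟙≤charge true false y = s≤s z≤n

charge-tight-inside : ∀ {m x y} → x ≡ true → y ≡ true → 𝟙 m ≡ charge m x y → m ≡ true
charge-tight-inside {true} refl refl _ = refl
charge-tight-inside {false} refl refl ()

charge-tight-outside : ∀ {m x y} → m ≡ true → x ≡ false → y ≡ false → 𝟙 m ≢ charge m x y
charge-tight-outside refl refl refl ()

module Matchings (G : BipGraph) (b : Fin (BipGraph.n G) → ℕ) where
  open BipGraph G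

  side : Fin n → Bool
  side = lookup A

  side-end₁ : ∀ e → side (end₁ e) ≡ true
  side-end₁ e = []=⇒lookup (end₁∈A e)

  side-end₂ : ∀ e → side (end₂ e) ≡ false
  side-end₂ e = lookup≡false (end₂∉A e)

  ∈B⇒side≡false : ∀ {u} → u ∈ B → side u ≡ false
  ∈B⇒side≡false u∈B = lookup≡false (x∈∁p⇒x∉p u∈B)

  end₁≢end₂ : ∀ e → end₁ e ≢ end₂ e
  end₁≢end₂ e eq = end₂∉A e (subst (_∈ A) eq (end₁∈A e))

  ends-opposite-sides : ∀ e → side (end₁ e) ≡ not (side (end₂ e))
  ends-opposite-sides e = trans (side-end₁ e) (cong not (sym (side-end₂ e)))

  adjacent-opposite-sides : ∀ {u v} → Adj G b u v → side u ≡ not (side v)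
  adjacent-opposite-sides (e , inj₁ (refl , refl)) = ends-opposite-sides e
  adjacent-opposite-sides (e , inj₂ (refl , refl)) rewrite side-end₁ e | side-end₂ e = refl

  incident : Fin m → Fin n → Bool
  incident e v = ⌊ end₁ e ≟ v ⌋ ∨ ⌊ end₂ e ≟ v ⌋

  incident-end₁ : ∀ e → incident e (end₁ e) ≡ true
  incident-end₁ e with end₁ e ≟ end₁ e
  ... | yes _ = refl
  ... | no ≢ = contradiction refl ≢

  incident-end₂ : ∀ e → incident e (end₂ e) ≡ true
  incident-end₂ e with end₂ e ≟ end₂ e
  ... | yes _ = ∨-zeroʳ _
  ... | no ≢ = contradiction refl ≢

  lookup-inc : ∀ v e → lookup (inc G b v) e ≡ incident e v
  lookup-inc v e = lookup∘tabulate (λ e → incident e v) e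

  deg≡∑ : ∀ M v → deg G b M v ≡ ∑ (λ e → 𝟙 (lookup M e ∧ incident e v))
  deg≡∑ M v = trans (∣p∣≡∑𝟙 (M ∩ inc G b v)) (sum-cong-≗ λ e →
    cong 𝟙 (trans (lookup-zipWith _∧_ e M (inc G b v)) (cong (lookup M e ∧_) (lookup-inc v e))))

  deg-positive : ∀ M {e v} → lookup M e ≡ true → incident e v ≡ true → 0 < deg G b M v
  deg-positive M {e} {v} e∈M e~v = ≤-<-trans z≤n (x∈p⇒∣p-x∣<∣p∣ (x∈p∩q⁺ (lookup⇒[]= e M e∈M ,
    lookup⇒[]= e (inc G b v) (trans (lookup-inc v e) e~v))))

  incident-split : ∀ e v x → 𝟙 (incident e v) * x ≡ 𝟙 ⌊ end₁ e ≟ v ⌋ * x + 𝟙 ⌊ end₂ e ≟ v ⌋ * x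
  incident-split e v x with end₁ e ≟ v | end₂ e ≟ v
  ... | yes refl | yes e₂≡e₁ = contradiction (sym e₂≡e₁) (end₁≢end₂ e)
  ... | yes _ | no _ = sym (+-identityʳ _)
  ... | no _ | yes _ = refl
  ... | no _ | no _ = refl

  ∑-incident : ∀ e (x : Fin n → ℕ) → ∑ (λ v → 𝟙 (incident e v) * x v) ≡ x (end₁ e) + x (end₂ e)
  ∑-incident e x = trans (sum-cong-≗ (λ v → incident-split e v (x v)))
    (trans (∑-distrib-+ (λ v → 𝟙 ⌊ end₁ e ≟ v ⌋ * x v) (λ v → 𝟙 ⌊ end₂ e ≟ v ⌋ * x v))
           (cong₂ _+_ (∑-δ (end₁ e) x) (∑-δ (end₂ e) x)))

  weighted-handshake : ∀ M (x : Fin n → ℕ) →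
    ∑ (λ v → deg G b M v * x v) ≡ ∑ (λ e → 𝟙 (lookup M e) * (x (end₁ e) + x (end₂ e)))
  weighted-handshake M x = begin
    ∑ (λ v → deg G b M v * x v)                 ≡⟨ sum-cong-≗ deg*x ⟩
    ∑ (λ v → ∑ (λ e → term v e))                ≡⟨ ∑-comm term ⟩
    ∑ (λ e → ∑ (λ v → term v e))                ≡⟨ sum-cong-≗ at-edge ⟩
    ∑ (λ e → 𝟙 (lookup M e) * (x (end₁ e) + x (end₂ e))) ∎
    where
    open ≡-Reasoning
    term : Fin n → Fin m → ℕ
    term v e = 𝟙 (lookup M e ∧ incident e v) * x v
    deg*x : ∀ v → deg G b M v * x v ≡ ∑ (term v)
    deg*x v = trans (cong (_* x v) (deg≡∑ M v)) (*-distribʳ-sum (x v) (λ e → 𝟙 (lookup M e ∧ incident e v)))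
    at-edge : ∀ e → ∑ (λ v → 𝟙 (lookup M e ∧ incident e v) * x v) ≡ 𝟙 (lookup M e) * (x (end₁ e) + x (end₂ e))
    at-edge e with lookup M e
    ... | false = sum-replicate-zero n
    ... | true = trans (∑-incident e x) (sym (*-identityˡ _))

  flexConn-invariant : ∀ {ℓ} {X : Set ℓ} (f : Fin n → X) →
    (∀ {e} → Flexible G b e → f (end₁ e) ≡ f (end₂ e)) → ∀ {u v} → FlexConn G b u v → f u ≡ f v
  flexConn-invariant f inv = fold (λ u v → f u ≡ f v) step refl
    where
    step : ∀ {u v w} → FlexAdj G b u v → f v ≡ f w → f u ≡ f w
    step (e , flex , inj₁ (refl , refl)) = trans (inv flex)
    step (e , flex , inj₂ (refl , refl)) = trans (sym (inv flex))

  flexible-invariant⇒separating : (Y : Subset n) →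
    (∀ {e} → Flexible G b e → lookup Y (end₁ e) ≡ lookup Y (end₂ e)) → Separating G b Y
  flexible-invariant⇒separating Y inv = inj₂ (Y , λ v → (λ v∈Y → v , v∈Y , ε) ,
    λ { (r , r∈Y , r~v) →
          lookup⇒[]= v Y (trans (sym (flexConn-invariant (lookup Y) inv r~v)) ([]=⇒lookup r∈Y)) })

  module Cover (Z : Subset n) where

    outside-Z : Fin n → ℕ
    outside-Z v = 𝟙 (not (lookup Z v))

    edgeCharge : Subset m → Fin m → ℕ
    edgeCharge M e = charge (lookup M e) (lookup Z (end₁ e)) (lookup Z (end₂ e))

    𝟙≤edgeCharge : ∀ M e → 𝟙 (lookup M e) ≤ edgeCharge M e
    𝟙≤edgeCharge M e = 𝟙≤charge (lookup M e) (lookup Z (end₁ e)) (lookup Z (end₂ e))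

    lookup-EdgesIn : ∀ e → lookup (EdgesIn G b Z) e ≡ lookup Z (end₁ e) ∧ lookup Z (end₂ e)
    lookup-EdgesIn e = trans (lookup∘tabulate _ e)
      (cong₂ _∧_ (⌊x∈?p⌋≡lookup (end₁ e) Z) (⌊x∈?p⌋≡lookup (end₂ e) Z))

    ∑edgeCharge : ∀ M → ∑ (edgeCharge M) ≡ ∣ EdgesIn G b Z ∣ + ∑ (λ v → deg G b M v * outside-Z v)
    ∑edgeCharge M = trans
      (∑-distrib-+ (λ e → 𝟙 (lookup Z (end₁ e) ∧ lookup Z (end₂ e)))
                   (λ e → 𝟙 (lookup M e) * (outside-Z (end₁ e) + outside-Z (end₂ e))))
      (cong₂ _+_ (sym (trans (∣p∣≡∑𝟙 (EdgesIn G b Z)) (sum-cong-≗ (cong 𝟙 ∘ lookup-EdgesIn))))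
                 (sym (weighted-handshake M outside-Z)))

    bSum-outside : bSum G b (∁ Z) ≡ ∑ (λ v → b v * outside-Z v)
    bSum-outside = trans (sum∘tabulate (λ v → if ⌊ v ∈? ∁ Z ⌋ then b v else 0)) (sum-cong-≗ λ v →
      trans (cong (if_then b v else 0) (trans (⌊x∈?p⌋≡lookup v (∁ Z)) (lookup-map v not Z)))
            (if-then-0≡*𝟙 (not (lookup Z v)) (b v)))

    parity : Fin n → Bool
    parity v = lookup Z v xor side v

    lookup-Z₁ : ∀ v → lookup (Z₁ G b Z) v ≡ not (parity v)
    lookup-Z₁ v = trans (lookup-zipWith _∨_ v (Z ∩ A) (B ∩ ∁ Z)) (trans
      (cong₂ _∨_ (lookup-zipWith _∧_ v Z A)
        (trans (lookup-zipWith _∧_ v B (∁ Z)) (cong₂ _∧_ (lookup-map v not A) (lookup-map v not Z))))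
      (boolean (lookup Z v) (side v)))
      where
      boolean : ∀ z s → (z ∧ s) ∨ (not s ∧ not z) ≡ not (z xor s)
      boolean true true = refl
      boolean true false = refl
      boolean false true = refl
      boolean false false = refl

    lookup-Z₂ : ∀ v → lookup (Z₂ G b Z) v ≡ parity v
    lookup-Z₂ v = trans (lookup-zipWith _∨_ v (A ∩ ∁ Z) (Z ∩ B)) (trans
      (cong₂ _∨_ (trans (lookup-zipWith _∧_ v A (∁ Z)) (cong (side v ∧_) (lookup-map v not Z)))
        (trans (lookup-zipWith _∧_ v Z B) (cong (lookup Z v ∧_) (lookup-map v not A))))
      (boolean (lookup Z v) (side v)))
      where
      boolean : ∀ z s → (s ∧ not z) ∨ (z ∧ not s) ≡ z xor s
      boolean true true = refl
      boolean true false = refl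
      boolean false true = refl
      boolean false false = refl

  module Verifying (Z : Subset n) (verifying : BVerifying G b Z) where
    open Cover Z public

    M₀ : Subset m
    M₀ = proj₁ verifying

    M₀-maximum : IsMaximum G b M₀
    M₀-maximum = proj₁ (proj₂ verifying)

    maximum-size : ∀ M → IsMaximum G b M → ∣ M ∣ ≡ ∣ EdgesIn G b Z ∣ + ∑ (λ v → b v * outside-Z v)
    maximum-size M (M-matching , M-max) = begin
      ∣ M ∣                               ≡⟨ ≤-antisym (proj₂ M₀-maximum M M-matching) (M-max M₀ (proj₁ M₀-maximum)) ⟩
      ∣ M₀ ∣                              ≡⟨ sym (proj₂ (proj₂ verifying)) ⟩
      bSum G b (∁ Z) + ∣ EdgesIn G b Z ∣  ≡⟨ +-comm (bSum G b (∁ Z)) ∣ EdgesIn G b Z ∣ ⟩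
      ∣ EdgesIn G b Z ∣ + bSum G b (∁ Z)  ≡⟨ cong (∣ EdgesIn G b Z ∣ +_) bSum-outside ⟩
      ∣ EdgesIn G b Z ∣ + ∑ (λ v → b v * outside-Z v) ∎
      where open ≡-Reasoning

    maximum-tight : ∀ M → IsMaximum G b M →
      (∀ e → 𝟙 (lookup M e) ≡ edgeCharge M e) × (∀ v → deg G b M v * outside-Z v ≡ b v * outside-Z v)
    maximum-tight M M-maximum =
      ∑-mono-≤-tight (𝟙≤edgeCharge M) ∑charge≤∣M∣ ,
      ∑-mono-≤-tight deg≤b (+-cancelˡ-≤ E _ _ E+∑b≤E+∑deg)
      where
      open ≤-Reasoning
      E ∑deg ∑b : ℕ
      E = ∣ EdgesIn G b Z ∣
      ∑deg = ∑ (λ v → deg G b M v * outside-Z v)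
      ∑b = ∑ (λ v → b v * outside-Z v)
      deg≤b : ∀ v → deg G b M v * outside-Z v ≤ b v * outside-Z v
      deg≤b v = *-monoˡ-≤ (outside-Z v) (proj₁ M-maximum v)
      ∑charge≤∣M∣ : ∑ (edgeCharge M) ≤ ∑ (𝟙 ∘ lookup M)
      ∑charge≤∣M∣ = begin
        ∑ (edgeCharge M)  ≡⟨ ∑edgeCharge M ⟩
        E + ∑deg          ≤⟨ +-monoʳ-≤ E (∑-mono-≤ deg≤b) ⟩
        E + ∑b            ≡⟨ sym (maximum-size M M-maximum) ⟩
        ∣ M ∣             ≡⟨ ∣p∣≡∑𝟙 M ⟩
        ∑ (𝟙 ∘ lookup M)  ∎
      E+∑b≤E+∑deg : E + ∑b ≤ E + ∑deg
      E+∑b≤E+∑deg = begin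
        E + ∑b            ≡⟨ sym (maximum-size M M-maximum) ⟩
        ∣ M ∣             ≡⟨ ∣p∣≡∑𝟙 M ⟩
        ∑ (𝟙 ∘ lookup M)  ≤⟨ ∑-mono-≤ (𝟙≤edgeCharge M) ⟩
        ∑ (edgeCharge M)  ≡⟨ ∑edgeCharge M ⟩
        E + ∑deg          ∎

    inside-edge∈maximum : ∀ M {e} → IsMaximum G b M →
      lookup Z (end₁ e) ≡ true → lookup Z (end₂ e) ≡ true → lookup M e ≡ true
    inside-edge∈maximum M {e} M-maximum z₁ z₂ = charge-tight-inside z₁ z₂ (proj₁ (maximum-tight M M-maximum) e)

    outside-edge∉maximum : ∀ M {e} → IsMaximum G b M → lookup M e ≡ true →
      lookup Z (end₁ e) ≡ false → lookup Z (end₂ e) ≡ false → ⊥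
    outside-edge∉maximum M {e} M-maximum e∈M z₁ z₂ =
      charge-tight-outside e∈M z₁ z₂ (proj₁ (maximum-tight M M-maximum) e)

    𝒟⊆Z : ∀ {v} → InD G b v → lookup Z v ≡ true
    𝒟⊆Z {v} (M , M-maximum , loose) with lookup Z v in v∉Z
    ... | true = refl
    ... | false = contradiction deg≡b (<⇒≢ loose)
      where
      deg≡b : deg G b M v ≡ b v
      deg≡b = *-cancelʳ-≡ _ _ 1 (subst (λ o → deg G b M v * 𝟙 (not o) ≡ b v * 𝟙 (not o)) v∉Z
        (proj₂ (maximum-tight M M-maximum) v))

    flexible-crosses-Z : ∀ {e} → Flexible G b e → lookup Z (end₁ e) ≡ not (lookup Z (end₂ e))
    flexible-crosses-Z {e} (allowed@(M , M-maximum , e∈M) , not-inevitable)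
      with lookup Z (end₁ e) in z₁ | lookup Z (end₂ e) in z₂
    ... | true | true = contradiction
      (allowed , λ M′ M′-maximum → lookup⇒[]= e M′ (inside-edge∈maximum M′ M′-maximum z₁ z₂)) not-inevitable
    ... | false | false = ⊥-elim (outside-edge∉maximum M M-maximum ([]=⇒lookup e∈M) z₁ z₂)
    ... | true | false = refl
    ... | false | true = refl

    inside-edge-deg-positive : ∀ {v u} → Adj G b v u → lookup Z v ≡ true → lookup Z u ≡ true → 0 < deg G b M₀ v
    inside-edge-deg-positive (e , inj₁ (refl , refl)) z₁ z₂ =
      deg-positive M₀ (inside-edge∈maximum M₀ M₀-maximum z₁ z₂) (incident-end₁ e)
    inside-edge-deg-positive (e , inj₂ (refl , refl)) z₂ z₁ =
      deg-positive M₀ (inside-edge∈maximum M₀ M₀-maximum z₁ z₂) (incident-end₂ e)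

    inactive-outside-Z : ∀ {v u} → b v ≡ 0 → Adj G b v u → lookup Z u ≡ true → lookup Z v ≡ false
    inactive-outside-Z {v} b≡0 v~u u∈Z with lookup Z v in v∈Z
    ... | false = refl
    ... | true = contradiction (≤-trans (inside-edge-deg-positive v~u v∈Z u∈Z) deg≤0) λ ()
      where
      deg≤0 : deg G b M₀ v ≤ 0
      deg≤0 = subst (deg G b M₀ v ≤_) b≡0 (proj₁ M₀-maximum v)

    parity-flexible : ∀ {e} → Flexible G b e → parity (end₁ e) ≡ parity (end₂ e)
    parity-flexible {e} flex = trans (cong₂ _xor_ (flexible-crosses-Z flex) (ends-opposite-sides e))
      (not-xor-not (lookup Z (end₂ e)) (side (end₂ e)))

    parity-component : ∀ {r v} → InComp G b r v → parity r ≡ parity v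
    parity-component = flexConn-invariant parity parity-flexible

    Z₁-separating : Separating G b (Z₁ G b Z)
    Z₁-separating = flexible-invariant⇒separating (Z₁ G b Z) λ flex →
      trans (lookup-Z₁ _) (trans (cong not (parity-flexible flex)) (sym (lookup-Z₁ _)))

    Z₂-separating : Separating G b (Z₂ G b Z)
    Z₂-separating = flexible-invariant⇒separating (Z₂ G b Z) λ flex →
      trans (lookup-Z₂ _) (trans (parity-flexible flex) (sym (lookup-Z₂ _)))

    hooked⇒parity : ∀ {W c r} → (∀ {u} → u ∈ W → side u ≡ c) → InconsistentHooked G b W r → parity r ≡ not c
    hooked⇒parity {c = c} {r} side-W (inj₁ (_ , v , r~v , v∈𝒟 , v∈W)) = begin
      parity r                ≡⟨ parity-component r~v ⟩
      lookup Z v xor side v   ≡⟨ cong₂ _xor_ (𝒟⊆Z v∈𝒟) (side-W v∈W) ⟩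
      true xor c              ∎
      where open ≡-Reasoning
    hooked⇒parity {c = c} {r} side-W (inj₂ (v , (b≡0 , comp) , u , v~u , u∈𝒟 , u∈W)) = begin
      parity r                ≡⟨ parity-component (proj₂ (comp v) refl) ⟩
      lookup Z v xor side v   ≡⟨ cong₂ _xor_ (inactive-outside-Z b≡0 v~u (𝒟⊆Z u∈𝒟))
                                             (trans (adjacent-opposite-sides v~u) (cong not (side-W u∈W))) ⟩
      false xor not c         ∎
      where open ≡-Reasoning

    hooked-by-A⇒parity≡false : ∀ {r} → InconsistentHooked G b A r → parity r ≡ false
    hooked-by-A⇒parity≡false = hooked⇒parity []=⇒lookup

    hooked-by-B⇒parity≡true : ∀ {r} → InconsistentHooked G b B r → parity r ≡ true
    hooked-by-B⇒parity≡true = hooked⇒parity ∈B⇒side≡false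

    component-in-Z₁ : ∀ {r v} → parity r ≡ false → InComp G b r v → v ∈ Z₁ G b Z
    component-in-Z₁ {r} {v} r-even r~v =
      lookup⇒[]= v (Z₁ G b Z) (trans (lookup-Z₁ v) (cong not (trans (sym (parity-component r~v)) r-even)))

    component-in-Z₂ : ∀ {r v} → parity r ≡ true → InComp G b r v → v ∈ Z₂ G b Z
    component-in-Z₂ {r} {v} r-odd r~v =
      lookup⇒[]= v (Z₂ G b Z) (trans (lookup-Z₂ v) (trans (sym (parity-component r~v)) r-odd))

mainTheorem11 : (G : BipGraph) (b : Fin (BipGraph.n G) → ℕ) (Z : Subset (BipGraph.n G))
    → BVerifying G b Z
    → (Separating G b (Z₁ G b Z) × Separating G b (Z₂ G b Z))
      × ((∀ r → InconsistentHooked G b (BipGraph.A G) r → ∀ v → InComp G b r v → v ∈ Z₁ G b Z)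
         × (∀ r → InconsistentHooked G b (BipGraph.B G) r → ∀ v → InComp G b r v → v ∈ Z₂ G b Z))
      × (∀ r → ¬ (InconsistentHooked G b (BipGraph.A G) r × InconsistentHooked G b (BipGraph.B G) r))
mainTheorem11 G b Z verifying =
  (Z₁-separating , Z₂-separating) ,
  ((λ r hooked v → component-in-Z₁ (hooked-by-A⇒parity≡false hooked)) ,
   (λ r hooked v → component-in-Z₂ (hooked-by-B⇒parity≡true hooked))) ,
  λ r (hooked-A , hooked-B) →
    contradiction (trans (sym (hooked-by-A⇒parity≡false hooked-A)) (hooked-by-B⇒parity≡true hooked-B)) λ ()
  where
  open Matchings G b
  open Verifying Z verifying
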